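{- Let $\mathbb{K}$ be a commutative ring and $N\ge1$. Let $F$ be an $N$-tuple of formal power series in $N$ non-commuting indeterminates with coefficients in $\mathbb{K}$ whose $i$-th component is \[ F_i(X_1,\ldots,X_N)=X_i-\sum_{k\ge2}\sum_{\kappa\in[N]^k}H_{i,\kappa}X_\kappa. \] Then there exists an $N$-tuple $G$ of such power series with $F\circ G=G\circ F=I$ (where $I_i=X_i$). Moreover $G_i=X_i+\sum_{k\ge2}\sum_{\kappa\in[N]^k}G_{i,\kappa}X_\kappa$ with \[ G_{i,\kappa}=\sum_{\overrightarrow{\mathcal{T}}\in\overrightarrow{\mathbb{S}}_{i,\kappa}}\ \prod_{v\text{ internal}}H_{\tau(v),\overrightarrow{\mu}(v)}. \]
   Context: $[N]=\{1,\ldots,N\}$; for $\kappa\in[N]^k$, $X_\kappa=X_{\kappa_1}\cdots X_{\kappa_k}$; variables do not commute with each other but commute with coefficients; composition is substitution $(F\circ G)_i=F_i(G_1,\ldots,G_N)$. A rooted planar tree is a finite rooted tree (root $v_0$) in which the children of each vertex are linearly ordered, inducing a left-to-right order on the leaves; internal vertices are those with at least one child. $\overrightarrow{\mathbb{S}}_{i,\kappa}$ is the set of isomorphism classes (under order- and type-preserving rooted isomorphisms) of rooted planar trees with $k$ leaves in which every internal vertex has at least two children, together with a type function $\tau:V\to[N]$ with $\tau(v_0)=i$ and the $j$-th leaf having type $\kappa_j$. For an internal vertex $v$ with ordered children $w_1,\ldots,w_r$, $\overrightarrow{\mu}(v)=(\tau(w_1),\ldots,\tau(w_r))$. -}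

module Defs where

open import Level using (_⊔_)
open import Algebra.Bundles using (CommutativeRing)
open import Data.Nat using (ℕ; zero; suc; _≤_)
open import Data.Fin using (Fin; _≟_)
open import Data.Fin.Base using () 
open import Data.List using (List; []; _∷_; [_]; map; concatMap; length; zipWith; foldr; _++_)
open import Data.List.Base using (allFin)
open import Data.List.Relation.Unary.All using (All)
open import Data.Product using (_×_)
open import Relation.Binary.PropositionalEquality using (_≡_)
open import Relation.Nullary using (yes; no)

Word : ℕ → Set
Word N = List (Fin N)

allWords : (N : ℕ) → ℕ → List (Word N)
allWords N zero    = [ [] ]
allWords N (suc k) = concatMap (λ j → map (j ∷_) (allWords N k)) (allFin N)

-- All ways of cutting a word into a sequence of NONEMPTY consecutive pieces
-- w = w₁ w₂ … w_k  (each decomposition listed exactly once).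
splits : {A : Set} → List A → List (List (List A))
splits []      = [ [] ]
splits (a ∷ w) = concatMap step (splits w)
  where
  step : _ → _
  step []       = [ [ a ] ∷ [] ]
  step (p ∷ ps) = ([ a ] ∷ p ∷ ps) ∷ ((a ∷ p) ∷ ps) ∷ []

-- Rooted planar trees whose vertices carry a type in [N].
-- Planar trees up to order-preserving, type-preserving isomorphism are
-- exactly the elements of this inductive type.
data Tree (N : ℕ) : Set where
  leaf : Fin N → Tree N
  node : Fin N → List (Tree N) → Tree N

τ : ∀ {N} → Tree N → Fin N
τ (leaf j)   = j
τ (node i _) = i

mutual
  leaves : ∀ {N} → Tree N → Word N
  leaves (leaf j)    = [ j ]
  leaves (node _ ts) = leavesF ts

  leavesF : ∀ {N} → List (Tree N) → Word N
  leavesF []       = []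
  leavesF (t ∷ ts) = leaves t ++ leavesF ts

-- every internal vertex has at least two children
-- (a node with an empty child list would be a leaf, so internal vertices
--  are exactly the 'node's, and we require ≥ 2 children there)
data Reduced {N : ℕ} : Tree N → Set where
  leafR : ∀ j → Reduced (leaf j)
  nodeR : ∀ i ts → 2 ≤ length ts → All Reduced ts → Reduced (node i ts)

InS : ∀ {N} → Fin N → Word N → Tree N → Set
InS i κ t = Reduced t × (τ t ≡ i) × (leaves t ≡ κ)

module Series {c ℓ} (R : CommutativeRing c ℓ) (N : ℕ) where
  open CommutativeRing R

  Σl : List Carrier → Carrier
  Σl = foldr _+_ 0#

  Πl : List Carrier → Carrier
  Πl = foldr _*_ 1#

  PS : Set c
  PS = Word N → Carrier

  Tuple : Set c
  Tuple = Fin N → PS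

  _≋_ : Tuple → Tuple → Set ℓ
  F ≋ G = ∀ i w → F i w ≈ G i w

  Xvar : Fin N → PS
  Xvar i (j ∷ []) with i ≟ j
  ... | yes _ = 1#
  ... | no  _ = 0#
  Xvar i _ = 0#

  I : Tuple
  I = Xvar

  -- This is the substitution for G without constant terms (the only
  -- situation where substitution is defined and the one used here).
  _∘ₛ_ : Tuple → Tuple → Tuple
  (F ∘ₛ G) i w =
    Σl (concatMap (λ p → map (λ κ → F i κ * Πl (zipWith G κ p))
                             (allWords N (length p)))
                  (splits w))

  Fof : (Fin N → Word N → Carrier) → Tuple
  Fof H i []            = 0#
  Fof H i (j ∷ [])      = Xvar i (j ∷ [])
  Fof H i (a ∷ b ∷ w)   = - H i (a ∷ b ∷ w)

  mutual
    weight : (Fin N → Word N → Carrier) → Tree N → Carrier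
    weight H (leaf _)    = 1#
    weight H (node i ts) = H i (map τ ts) * weightF H ts

    weightF : (Fin N → Word N → Carrier) → List (Tree N) → Carrier
    weightF H []       = 1#
    weightF H (t ∷ ts) = weight H t * weightF H ts

module Submission where

-- Write F = X − Hₙₗ, where Hₙₗ collects the terms of degree ≥ 2. Since Hₙₗ has no linear terms, the
-- coefficient of a word of length n + 1 in Hₙₗ ∘ G only involves coefficients of G on words of length
-- ≤ n, so the iterates G₀ = X, Gₙ₊₁ = X + Hₙₗ ∘ Gₙ stabilise word by word to a solution of
-- G = X + Hₙₗ ∘ G, i.e. of F ∘ G = I. Composition is associative, which follows from the chain rule
-- ∂ₐ (A ∘ G) = ∑ₘ ∂ₐ Gₘ · (∂ₘ A ∘ G) for the left derivatives (∂ₐ A)_w = A_{a w}; the same length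
-- induction then gives G ∘ F = I. Expanding Gₙ₊₁ = X + Hₙₗ ∘ Gₙ, the term H_{i,ρ} X_ρ with
-- |ρ| ≥ 2 contributes a root of type i whose children, of types ρ, are trees contributing to Gₙ; so
-- Gₙ is the weighted sum over reduced planar trees of height ≤ n, and for n = |κ| these are exactly
-- the trees of S_{i,κ}.

open import Defs
open import Algebra.Bundles using (CommutativeRing; CommutativeSemiring)
open import Data.Nat using (ℕ; zero; suc; _≤_; _<_; z≤n; s≤s)
open import Data.Fin using (Fin; _≟_; zero; suc)
open import Data.List using (List; []; _∷_; [_]; length; map; concatMap; concat; zipWith; foldr; _++_; allFin; tabulate)
open import Data.List.Membership.Propositional using (_∈_)
open import Data.List.Relation.Unary.Any using (here; there)
open import Data.List.Relation.Binary.Permutation.Propositional using (_↭_; ↭⇒↭ₛ′)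
open import Data.List.Relation.Unary.Unique.Propositional using (Unique)
open import Data.Product using (Σ; ∃; _×_; _,_; proj₁; proj₂)
open import Data.Empty using (⊥)
open import Function using (_∘_; id)
open import Function.Bundles using (_⇔_)
open import Relation.Binary.PropositionalEquality as ≡ using (_≡_; _≢_)
open import Relation.Nullary using (yes; no; contradiction)

module ListSum {c ℓ} (S : CommutativeSemiring c ℓ) where
  open CommutativeSemiring S hiding (zero)
  open import Relation.Binary.Reasoning.Setoid setoid
  open import Data.List.Properties using (map-tabulate)
  import Data.List.Relation.Binary.Permutation.Propositional.Properties as Perm
  import Data.List.Relation.Binary.Permutation.Setoid.Properties setoid as Permₛ

  ∑ : {A : Set} → List A → (A → Carrier) → Carrier
  ∑ xs f = foldr _+_ 0# (map f xs)

  ∑-cong : {A : Set} (xs : List A) {f g : A → Carrier} → (∀ x → f x ≈ g x) → ∑ xs f ≈ ∑ xs g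
  ∑-cong []       f≈g = refl
  ∑-cong (x ∷ xs) f≈g = +-cong (f≈g x) (∑-cong xs f≈g)

  ∑-cong-∈ : {A : Set} (xs : List A) {f g : A → Carrier} → (∀ x → x ∈ xs → f x ≈ g x) → ∑ xs f ≈ ∑ xs g
  ∑-cong-∈ []       f≈g = refl
  ∑-cong-∈ (x ∷ xs) f≈g = +-cong (f≈g x (here ≡.refl)) (∑-cong-∈ xs (λ y y∈xs → f≈g y (there y∈xs)))

  ∑-zero : {A : Set} (xs : List A) {f : A → Carrier} → (∀ x → f x ≈ 0#) → ∑ xs f ≈ 0#
  ∑-zero []       f≈0 = refl
  ∑-zero (x ∷ xs) f≈0 = trans (+-cong (f≈0 x) (∑-zero xs f≈0)) (+-identityˡ 0#)

  ∑-distrib-+ : {A : Set} (xs : List A) (f g : A → Carrier) → ∑ xs (λ x → f x + g x) ≈ ∑ xs f + ∑ xs g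
  ∑-distrib-+ []       f g = sym (+-identityˡ 0#)
  ∑-distrib-+ (x ∷ xs) f g = trans (+-congˡ (∑-distrib-+ xs f g)) (interchange (f x) (g x) _ _)
    where open import Algebra.Properties.CommutativeSemigroup +-commutativeSemigroup using (interchange)

  *-distribˡ-∑ : {A : Set} (xs : List A) (a : Carrier) (f : A → Carrier) → ∑ xs (λ x → a * f x) ≈ a * ∑ xs f
  *-distribˡ-∑ []       a f = sym (zeroʳ a)
  *-distribˡ-∑ (x ∷ xs) a f = trans (+-congˡ (*-distribˡ-∑ xs a f)) (sym (distribˡ a (f x) _))

  *-distribʳ-∑ : {A : Set} (xs : List A) (a : Carrier) (f : A → Carrier) → ∑ xs (λ x → f x * a) ≈ ∑ xs f * a
  *-distribʳ-∑ []       a f = sym (zeroˡ a)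
  *-distribʳ-∑ (x ∷ xs) a f = trans (+-congˡ (*-distribʳ-∑ xs a f)) (sym (distribʳ a (f x) _))

  ∑-comm : {A B : Set} (xs : List A) (ys : List B) (f : A → B → Carrier) →
           ∑ xs (λ x → ∑ ys (f x)) ≈ ∑ ys (λ y → ∑ xs (λ x → f x y))
  ∑-comm []       ys f = sym (∑-zero ys (λ _ → refl))
  ∑-comm (x ∷ xs) ys f = begin
    ∑ ys (f x) + ∑ xs (λ x → ∑ ys (f x))             ≈⟨ +-congˡ (∑-comm xs ys f) ⟩
    ∑ ys (f x) + ∑ ys (λ y → ∑ xs (λ x → f x y))     ≈⟨ ∑-distrib-+ ys (f x) _ ⟨
    ∑ ys (λ y → f x y + ∑ xs (λ x → f x y))          ∎

  foldr-++ : (xs ys : List Carrier) → foldr _+_ 0# (xs ++ ys) ≈ foldr _+_ 0# xs + foldr _+_ 0# ys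
  foldr-++ []       ys = sym (+-identityˡ _)
  foldr-++ (x ∷ xs) ys = trans (+-congˡ (foldr-++ xs ys)) (sym (+-assoc _ _ _))

  foldr-concatMap : {A : Set} (xs : List A) (g : A → List Carrier) →
                    foldr _+_ 0# (concatMap g xs) ≈ ∑ xs (λ x → foldr _+_ 0# (g x))
  foldr-concatMap []       g = refl
  foldr-concatMap (x ∷ xs) g = trans (foldr-++ (g x) (concatMap g xs)) (+-congˡ (foldr-concatMap xs g))

  ∑-++ : {A : Set} (xs ys : List A) (f : A → Carrier) → ∑ (xs ++ ys) f ≈ ∑ xs f + ∑ ys f
  ∑-++ []       ys f = sym (+-identityˡ _)
  ∑-++ (x ∷ xs) ys f = trans (+-congˡ (∑-++ xs ys f)) (sym (+-assoc _ _ _))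

  ∑-map : {A B : Set} (xs : List A) (g : A → B) (f : B → Carrier) → ∑ (map g xs) f ≈ ∑ xs (f ∘ g)
  ∑-map []       g f = refl
  ∑-map (x ∷ xs) g f = +-congˡ (∑-map xs g f)

  ∑-concatMap : {A B : Set} (xs : List A) (g : A → List B) (f : B → Carrier) →
                ∑ (concatMap g xs) f ≈ ∑ xs (λ x → ∑ (g x) f)
  ∑-concatMap []       g f = refl
  ∑-concatMap (x ∷ xs) g f = trans (∑-++ (g x) (concatMap g xs) f) (+-congˡ (∑-concatMap xs g f))

  ∑-↭ : {A : Set} {xs ys : List A} (f : A → Carrier) → xs ↭ ys → ∑ xs f ≈ ∑ ys f
  ∑-↭ f xs↭ys = Permₛ.foldr-commMonoid +-isCommutativeMonoid (↭⇒↭ₛ′ isEquivalence (Perm.map⁺ f xs↭ys))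

  ∑-tabulate-δ : ∀ {n} (f : Fin n → Carrier) a → (∀ m → m ≢ a → f m ≈ 0#) → foldr _+_ 0# (tabulate f) ≈ f a
  ∑-tabulate-δ {suc n} f zero    f≈0 =
    trans (+-congˡ (∑-tabulate-zero (f ∘ suc) (λ m → f≈0 (suc m) (λ ())))) (+-identityʳ _)
    where
    ∑-tabulate-zero : ∀ {n} (g : Fin n → Carrier) → (∀ m → g m ≈ 0#) → foldr _+_ 0# (tabulate g) ≈ 0#
    ∑-tabulate-zero {zero}  g g≈0 = refl
    ∑-tabulate-zero {suc n} g g≈0 = trans (+-cong (g≈0 zero) (∑-tabulate-zero (g ∘ suc) (g≈0 ∘ suc))) (+-identityˡ 0#)
  ∑-tabulate-δ {suc n} f (suc a) f≈0 =
    trans (+-cong (f≈0 zero (λ ())) (∑-tabulate-δ (f ∘ suc) a (λ m m≢a → f≈0 (suc m) (m≢a ∘ Fin-suc-injective))))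
          (+-identityˡ _)
    where open import Data.Fin.Properties using () renaming (suc-injective to Fin-suc-injective)

  ∑-allFin-δ : ∀ {n} (f : Fin n → Carrier) a → (∀ m → m ≢ a → f m ≈ 0#) → ∑ (allFin n) f ≈ f a
  ∑-allFin-δ {n} f a f≈0 = trans (reflexive (≡.cong (foldr _+_ 0#) (map-tabulate id f))) (∑-tabulate-δ f a f≈0)

module Combinatorics where
  open import Data.List.Membership.Propositional using (find; lose)
  open import Data.List.Membership.Propositional.Properties using (∈-concatMap⁺; ∈-concatMap⁻; ∈-map⁺; ∈-map⁻; ∈-allFin)
  open import Data.List.Properties using (∷-injectiveʳ)
  open import Data.List.Relation.Unary.All as All using (All; []; _∷_)
  open import Data.List.Relation.Unary.AllPairs using ([]; _∷_)
  open import Data.List.Relation.Binary.Pointwise using (Pointwise; []; _∷_)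
  open import Data.List.Relation.Unary.Unique.Propositional.Properties using (++⁺; map⁺; allFin⁺)
  open import Data.Nat.Properties using (suc-injective)

  data NonEmpty {A : Set} : List A → Set where
    nonEmpty : ∀ {x xs} → NonEmpty (x ∷ xs)

  ∈-concatMap⁻′ : {A B : Set} (f : A → List B) (xs : List A) {y : B} → y ∈ concatMap f xs → ∃ λ x → x ∈ xs × y ∈ f x
  ∈-concatMap⁻′ f xs = find ∘ ∈-concatMap⁻ f

  ∈-concatMap⁺′ : {A B : Set} (f : A → List B) {xs : List A} {x : A} {y : B} → x ∈ xs → y ∈ f x → y ∈ concatMap f xs
  ∈-concatMap⁺′ f x∈xs y∈fx = ∈-concatMap⁺ f (lose x∈xs y∈fx)

  concatMap-Unique : {A B : Set} (f : A → List B) {xs : List A} → Unique xs → (∀ {x} → x ∈ xs → Unique (f x)) →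
                     (∀ {x y z} → x ∈ xs → y ∈ xs → z ∈ f x → z ∈ f y → x ≡ y) → Unique (concatMap f xs)
  concatMap-Unique f {[]}     _              _        _        = []
  concatMap-Unique f {x ∷ xs} (x∉xs ∷ !xs) !f disjoint = ++⁺ (!f (here ≡.refl))
    (concatMap-Unique f !xs (!f ∘ there) (λ x∈ y∈ → disjoint (there x∈) (there y∈)))
    (λ (z∈fx , z∈rest) → let y , y∈xs , z∈fy = ∈-concatMap⁻′ f xs z∈rest in
                         All.lookup x∉xs y∈xs (disjoint (here ≡.refl) (there y∈xs) z∈fx z∈fy))

  ∷-Unique : {A : Set} (x : A) {xs : List (List A)} → Unique xs → Unique (map (x ∷_) xs)
  ∷-Unique x = map⁺ ∷-injectiveʳ

  ∷-disjoint : {A : Set} {x y : A} {xss yss : List (List A)} {zs : List A} →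
               zs ∈ map (x ∷_) xss → zs ∈ map (y ∷_) yss → x ≡ y
  ∷-disjoint zs∈ zs∈′ with ∈-map⁻ _ zs∈ | ∈-map⁻ _ zs∈′
  ... | _ , _ , ≡.refl | _ , _ , ≡.refl = ≡.refl

  choices : {A : Set} → List (List A) → List (List A)
  choices []         = [ [] ]
  choices (xs ∷ xss) = concatMap (λ x → map (x ∷_) (choices xss)) xs

  ∈-choices⁻ : {A : Set} (xss : List (List A)) {ys : List A} → ys ∈ choices xss → Pointwise _∈_ ys xss
  ∈-choices⁻ []         (here ≡.refl) = []
  ∈-choices⁻ (xs ∷ xss) ys∈ with ∈-concatMap⁻′ (λ x → map (x ∷_) (choices xss)) xs ys∈
  ... | x , x∈xs , ys∈′ with ∈-map⁻ (x ∷_) ys∈′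
  ... | _ , ys′∈ , ≡.refl = x∈xs ∷ ∈-choices⁻ xss ys′∈

  ∈-choices⁺ : {A : Set} {xss : List (List A)} {ys : List A} → Pointwise _∈_ ys xss → ys ∈ choices xss
  ∈-choices⁺ []                               = here ≡.refl
  ∈-choices⁺ {xss = _ ∷ xss} {y ∷ ys} (y∈ ∷ ys∈) =
    ∈-concatMap⁺′ (λ x → map (x ∷_) (choices xss)) y∈ (∈-map⁺ (y ∷_) (∈-choices⁺ ys∈))

  choices-Unique : {A : Set} (xss : List (List A)) → All Unique xss → Unique (choices xss)
  choices-Unique []         _            = [] ∷ []
  choices-Unique (xs ∷ xss) (!xs ∷ !xss) =
    concatMap-Unique (λ x → map (x ∷_) (choices xss)) !xs
                     (λ _ → ∷-Unique _ (choices-Unique xss !xss)) (λ _ _ → ∷-disjoint)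

  allWords-length : ∀ N k {κ : Word N} → κ ∈ allWords N k → length κ ≡ k
  allWords-length N zero    (here ≡.refl) = ≡.refl
  allWords-length N (suc k) κ∈ with ∈-concatMap⁻′ (λ j → map (j ∷_) (allWords N k)) (allFin N) κ∈
  ... | j , _ , κ∈′ with ∈-map⁻ (j ∷_) κ∈′
  ... | _ , κ′∈ , ≡.refl = ≡.cong suc (allWords-length N k κ′∈)

  ∈-allWords : ∀ N k (κ : Word N) → length κ ≡ k → κ ∈ allWords N k
  ∈-allWords N zero    []      _     = here ≡.refl
  ∈-allWords N (suc k) (j ∷ κ) |κ|≡k =
    ∈-concatMap⁺′ (λ j → map (j ∷_) (allWords N k)) (∈-allFin j) (∈-map⁺ (j ∷_) (∈-allWords N k κ (suc-injective |κ|≡k)))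

  allWords-Unique : ∀ N k → Unique (allWords N k)
  allWords-Unique N zero    = [] ∷ []
  allWords-Unique N (suc k) =
    concatMap-Unique (λ j → map (j ∷_) (allWords N k)) (allFin⁺ N)
                     (λ _ → ∷-Unique _ (allWords-Unique N k)) (λ _ _ → ∷-disjoint)

  All-zipWith : {A B C : Set} {P : C → Set} (f : A → B → C) → (∀ x y → P (f x y)) →
                ∀ xs ys → All P (zipWith f xs ys)
  All-zipWith f Pf []       _        = []
  All-zipWith f Pf (_ ∷ _)  []       = []
  All-zipWith f Pf (x ∷ xs) (y ∷ ys) = Pf x y ∷ All-zipWith f Pf xs ys

  -- `splits` keeps its step function local; restating it makes the step available to proofs.
  splitStep : {A : Set} → A → List (List A) → List (List (List A))
  splitStep a []       = [ [ a ] ∷ [] ]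
  splitStep a (p ∷ ps) = ([ a ] ∷ p ∷ ps) ∷ ((a ∷ p) ∷ ps) ∷ []

  splits′ : {A : Set} → List A → List (List (List A))
  splits′ []      = [ [] ]
  splits′ (a ∷ w) = concatMap (splitStep a) (splits′ w)

  splits≡splits′ : {A : Set} (w : List A) → splits w ≡ splits′ w
  splits≡splits′ []      = ≡.refl
  splits≡splits′ (a ∷ w) =
    ≡.trans (≡.cong concat (map-cong (λ { [] → ≡.refl ; (_ ∷ _) → ≡.refl }) (splits w)))
            (≡.cong (concatMap (splitStep a)) (splits≡splits′ w))
    where open import Data.List.Properties using (map-cong)

  concat-splits : {A : Set} (w : List A) {p : List (List A)} → p ∈ splits′ w → concat p ≡ w
  concat-splits []      (here ≡.refl) = ≡.refl
  concat-splits (a ∷ w) p∈ with ∈-concatMap⁻′ (splitStep a) (splits′ w) p∈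
  ... | []     , p′∈ , here ≡.refl         = ≡.cong (a ∷_) (concat-splits w p′∈)
  ... | _ ∷ _ , p′∈ , here ≡.refl         = ≡.cong (a ∷_) (concat-splits w p′∈)
  ... | _ ∷ _ , p′∈ , there (here ≡.refl) = ≡.cong (a ∷_) (concat-splits w p′∈)

  splits-NonEmpty : {A : Set} (w : List A) {p : List (List A)} → p ∈ splits′ w → All NonEmpty p
  splits-NonEmpty []      (here ≡.refl) = []
  splits-NonEmpty (a ∷ w) p∈ with ∈-concatMap⁻′ (splitStep a) (splits′ w) p∈
  ... | []     , p′∈ , here ≡.refl         = nonEmpty ∷ []
  ... | _ ∷ _ , p′∈ , here ≡.refl         = nonEmpty ∷ splits-NonEmpty w p′∈
  ... | _ ∷ _ , p′∈ , there (here ≡.refl) = nonEmpty ∷ All.tail (splits-NonEmpty w p′∈)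

  ∈-splits : {A : Set} (w : List A) (p : List (List A)) → All NonEmpty p → concat p ≡ w → p ∈ splits′ w
  ∈-splits []      []                  _              _      = here ≡.refl
  ∈-splits []      (_ ∷ _)             (nonEmpty ∷ _) ()
  ∈-splits (a ∷ w) ((x ∷ []) ∷ [])     (_ ∷ ne)       ≡.refl =
    ∈-concatMap⁺′ (splitStep x) (∈-splits w [] ne ≡.refl) (here ≡.refl)
  ∈-splits (a ∷ w) ((x ∷ []) ∷ q ∷ qs) (_ ∷ ne)       ≡.refl =
    ∈-concatMap⁺′ (splitStep x) (∈-splits w (q ∷ qs) ne ≡.refl) (here ≡.refl)
  ∈-splits (a ∷ w) ((x ∷ y ∷ ys) ∷ ps) (_ ∷ ne)       ≡.refl =
    ∈-concatMap⁺′ (splitStep x) (∈-splits w ((y ∷ ys) ∷ ps) (nonEmpty ∷ ne) ≡.refl) (there (here ≡.refl))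

  splits-Unique : {A : Set} (w : List A) → Unique (splits′ w)
  splits-Unique []      = [] ∷ []
  splits-Unique (a ∷ w) = concatMap-Unique (splitStep a) (splits-Unique w) step-Unique
    (λ {p} {p′} p∈ p′∈ z∈ z∈′ → ≡.trans (≡.sym (unstep-splitStep (splits-NonEmpty w p∈) z∈))
                                         (unstep-splitStep (splits-NonEmpty w p′∈) z∈′))
    where
    step-Unique : ∀ {p} → p ∈ splits′ w → Unique (splitStep a p)
    step-Unique {[]}     _ = [] ∷ []
    step-Unique {q ∷ ps} _ = ((λ ()) ∷ []) ∷ [] ∷ []
    unstep : List (List _) → List (List _)
    unstep ((_ ∷ [])         ∷ ps) = ps
    unstep ((_ ∷ q@(_ ∷ _)) ∷ ps) = q ∷ ps
    unstep _                       = []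
    unstep-splitStep : ∀ {p z} → All NonEmpty p → z ∈ splitStep a p → unstep z ≡ p
    unstep-splitStep {[]}     _                  (here ≡.refl)         = ≡.refl
    unstep-splitStep {q ∷ ps} _                  (here ≡.refl)         = ≡.refl
    unstep-splitStep {q ∷ ps} (nonEmpty ∷ _)    (there (here ≡.refl)) = ≡.refl

module PowerSeries {c ℓ} (R : CommutativeRing c ℓ) (N : ℕ) where
  open Combinatorics using (splitStep; splits′; splits≡splits′)
  open CommutativeRing R hiding (zero)
  open Series R N
  open ListSum commutativeSemiring public
  open import Relation.Binary.Reasoning.Setoid setoid
  open import Data.Nat.Properties using (≤-refl; ≤-trans; m≤n⇒m≤1+n; n≤1+n)
  open import Algebra.Properties.CommutativeSemigroup *-commutativeSemigroup using (x∙yz≈y∙xz)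

  ∑Fin : (Fin N → Carrier) → Carrier
  ∑Fin = ∑ (allFin N)

  infix 4 _≈[≤_]_ _≈[<_]_ _≋[≤_]_

  _≈[≤_]_ : PS → ℕ → PS → Set ℓ
  B ≈[≤ n ] C = ∀ u → length u ≤ n → B u ≈ C u

  _≈[<_]_ : PS → ℕ → PS → Set ℓ
  B ≈[< n ] C = ∀ u → length u < n → B u ≈ C u

  _≋[≤_]_ : Tuple → ℕ → Tuple → Set ℓ
  G ≋[≤ n ] G' = ∀ m → G m ≈[≤ n ] G' m

  ≈[≤]-weaken : ∀ {m n B C} → m ≤ n → B ≈[≤ n ] C → B ≈[≤ m ] C
  ≈[≤]-weaken m≤n B≈C u |u|≤m = B≈C u (≤-trans |u|≤m m≤n)

  ∂ : Fin N → PS → PS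
  ∂ a B w = B (a ∷ w)

  const : Carrier → PS
  const a []      = a
  const a (_ ∷ _) = 0#

  -- (B · C) w = ∑_{w = u v} B u * C v, unfolded along the first letter of w.
  infixl 7 _·_
  _·_ : PS → PS → PS
  (B · C) []      = B [] * C []
  (B · C) (a ∷ w) = B [] * C (a ∷ w) + (∂ a B · C) w

  ·-cong-≤ : ∀ {B B' C C'} w → B ≈[≤ length w ] B' → C ≈[≤ length w ] C' → (B · C) w ≈ (B' · C') w
  ·-cong-≤ []      B≈B' C≈C' = *-cong (B≈B' [] z≤n) (C≈C' [] z≤n)
  ·-cong-≤ (a ∷ w) B≈B' C≈C' =
    +-cong (*-cong (B≈B' [] z≤n) (C≈C' (a ∷ w) ≤-refl))
           (·-cong-≤ w (λ u |u|≤|w| → B≈B' (a ∷ u) (s≤s |u|≤|w|)) (λ v |v|≤|w| → C≈C' v (m≤n⇒m≤1+n |v|≤|w|)))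

  ·-cong : ∀ {B B' C C'} → (∀ u → B u ≈ B' u) → (∀ v → C v ≈ C' v) → ∀ w → (B · C) w ≈ (B' · C') w
  ·-cong B≈B' C≈C' w = ·-cong-≤ w (λ u _ → B≈B' u) (λ v _ → C≈C' v)

  ·-cong-<  : ∀ {B B' C C'} w → C [] ≈ 0# → C' [] ≈ 0# →
              B ≈[< length w ] B' → C ≈[≤ length w ] C' → (B · C) w ≈ (B' · C') w
  ·-cong-< []      C₀≈0 C'₀≈0 _ _ = trans (*-congˡ C₀≈0) (trans (zeroʳ _) (sym (trans (*-congˡ C'₀≈0) (zeroʳ _))))
  ·-cong-< (a ∷ w) C₀≈0 C'₀≈0 B≈B' C≈C' =
    +-cong (*-cong (B≈B' [] (s≤s z≤n)) (C≈C' (a ∷ w) ≤-refl))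
           (·-cong-< w C₀≈0 C'₀≈0 (λ u |u|<|w| → B≈B' (a ∷ u) (s≤s |u|<|w|)) (λ v |v|≤|w| → C≈C' v (m≤n⇒m≤1+n |v|≤|w|)))

  private
    *-linearʳ : ∀ a x y p → (a * x + y) * p ≈ a * (x * p) + y * p
    *-linearʳ a x y p = trans (distribʳ p (a * x) y) (+-congʳ (*-assoc a x p))

    *-linearˡ : ∀ a x y p → p * (a * x + y) ≈ a * (p * x) + p * y
    *-linearˡ a x y p = trans (distribˡ p (a * x) y) (+-congʳ (x∙yz≈y∙xz p a x))

    +-linear : ∀ a x₁ y₁ x₂ y₂ → (a * x₁ + y₁) + (a * x₂ + y₂) ≈ a * (x₁ + x₂) + (y₁ + y₂)
    +-linear a x₁ y₁ x₂ y₂ = trans (interchange _ _ _ _) (+-congʳ (sym (distribˡ a x₁ x₂)))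
      where open import Algebra.Properties.CommutativeSemigroup +-commutativeSemigroup using (interchange)

  ·-linearˡ : ∀ a X Y D w → ((λ u → a * X u + Y u) · D) w ≈ a * (X · D) w + (Y · D) w
  ·-linearˡ a X Y D []      = *-linearʳ a (X []) (Y []) (D [])
  ·-linearˡ a X Y D (b ∷ w) =
    trans (+-cong (*-linearʳ a (X []) (Y []) (D (b ∷ w))) (·-linearˡ a (∂ b X) (∂ b Y) D w)) (+-linear a _ _ _ _)

  ·-linearʳ : ∀ a X Y B w → (B · (λ u → a * X u + Y u)) w ≈ a * (B · X) w + (B · Y) w
  ·-linearʳ a X Y B []      = *-linearˡ a (X []) (Y []) (B [])
  ·-linearʳ a X Y B (b ∷ w) =
    trans (+-cong (*-linearˡ a (X (b ∷ w)) (Y (b ∷ w)) (B [])) (·-linearʳ a X Y (∂ b B) w)) (+-linear a _ _ _ _)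

  ·-zeroˡ : ∀ C w → ((λ _ → 0#) · C) w ≈ 0#
  ·-zeroˡ C []      = zeroˡ _
  ·-zeroˡ C (b ∷ w) = trans (+-cong (zeroˡ _) (·-zeroˡ C w)) (+-identityˡ 0#)

  ·-zeroʳ : ∀ B w → (B · (λ _ → 0#)) w ≈ 0#
  ·-zeroʳ B []      = zeroʳ _
  ·-zeroʳ B (b ∷ w) = trans (+-cong (zeroʳ _) (·-zeroʳ (∂ b B) w)) (+-identityˡ 0#)

  ·-distribʳ-∑ : {A : Set} (xs : List A) (f : A → PS) (D : PS) →
                 ∀ w → ((λ u → ∑ xs (λ x → f x u)) · D) w ≈ ∑ xs (λ x → (f x · D) w)
  ·-distribʳ-∑ []       f D w = ·-zeroˡ D w
  ·-distribʳ-∑ (x ∷ xs) f D w = begin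
    ((λ u → f x u + ∑ xs (λ x → f x u)) · D) w         ≈⟨ ·-cong (λ u → +-congʳ (*-identityˡ _)) (λ _ → refl) w ⟨
    ((λ u → 1# * f x u + ∑ xs (λ x → f x u)) · D) w    ≈⟨ ·-linearˡ 1# (f x) _ D w ⟩
    1# * (f x · D) w + ((λ u → ∑ xs (λ x → f x u)) · D) w ≈⟨ +-cong (*-identityˡ _) (·-distribʳ-∑ xs f D w) ⟩
    (f x · D) w + ∑ xs (λ x → (f x · D) w)             ∎

  ·-distribˡ-∑ : {A : Set} (xs : List A) (g : A → PS) (B : PS) →
                 ∀ w → (B · (λ u → ∑ xs (λ x → g x u))) w ≈ ∑ xs (λ x → (B · g x) w)
  ·-distribˡ-∑ []       g B w = ·-zeroʳ B w
  ·-distribˡ-∑ (x ∷ xs) g B w = begin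
    (B · (λ u → g x u + ∑ xs (λ x → g x u))) w         ≈⟨ ·-cong (λ _ → refl) (λ u → +-congʳ (*-identityˡ _)) w ⟨
    (B · (λ u → 1# * g x u + ∑ xs (λ x → g x u))) w    ≈⟨ ·-linearʳ 1# (g x) _ B w ⟩
    1# * (B · g x) w + (B · (λ u → ∑ xs (λ x → g x u))) w ≈⟨ +-cong (*-identityˡ _) (·-distribˡ-∑ xs g B w) ⟩
    (B · g x) w + ∑ xs (λ x → (B · g x) w)             ∎

  ·-assoc : ∀ B C D w → ((B · C) · D) w ≈ (B · (C · D)) w
  ·-assoc B C D []      = *-assoc _ _ _
  ·-assoc B C D (a ∷ w) = begin
    (B [] * C []) * D (a ∷ w) + (∂ a (B · C) · D) w
      ≈⟨ +-cong (*-assoc _ _ _) (·-linearˡ (B []) (∂ a C) (∂ a B · C) D w) ⟩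
    B [] * (C [] * D (a ∷ w)) + (B [] * (∂ a C · D) w + ((∂ a B · C) · D) w)
      ≈⟨ +-congˡ (+-congˡ (·-assoc (∂ a B) C D w)) ⟩
    B [] * (C [] * D (a ∷ w)) + (B [] * (∂ a C · D) w + (∂ a B · (C · D)) w)
      ≈⟨ +-assoc _ _ _ ⟨
    (B [] * (C [] * D (a ∷ w)) + B [] * (∂ a C · D) w) + (∂ a B · (C · D)) w
      ≈⟨ +-congʳ (distribˡ _ _ _) ⟨
    B [] * (C [] * D (a ∷ w) + (∂ a C · D) w) + (∂ a B · (C · D)) w ∎

  ·-constˡ : ∀ a C w → (const a · C) w ≈ a * C w
  ·-constˡ a C []      = refl
  ·-constˡ a C (b ∷ w) = trans (+-congˡ (·-zeroˡ C w)) (+-identityʳ _)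

  ·-constʳ : ∀ a B w → (B · const a) w ≈ B w * a
  ·-constʳ a B []      = refl
  ·-constʳ a B (b ∷ w) = trans (+-cong (zeroʳ _) (·-constʳ a (∂ b B) w)) (+-identityˡ _)

  infixl 8 _⟦_⟧
  _⟦_⟧ : PS → Tuple → PS
  (A ⟦ G ⟧) w = Σl (concatMap (λ p → map (λ κ → A κ * Πl (zipWith G κ p)) (allWords N (length p))) (splits w))

  blockTerm : PS → Tuple → List (Word N) → Carrier
  blockTerm A G p = ∑ (allWords N (length p)) (λ κ → A κ * Πl (zipWith G κ p))

  ⟦⟧-blocks : ∀ A G w → (A ⟦ G ⟧) w ≈ ∑ (splits′ w) (blockTerm A G)
  ⟦⟧-blocks A G w =
    trans (foldr-concatMap (splits w) _) (reflexive (≡.cong (λ ps → ∑ ps (blockTerm A G)) (splits≡splits′ w)))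

  ⟦⟧-[] : ∀ A G → (A ⟦ G ⟧) [] ≈ A []
  ⟦⟧-[] A G = trans (⟦⟧-blocks A G []) (trans (+-identityʳ _) (trans (+-identityʳ _) (*-identityʳ _)))

  headBlockTerm : PS → Tuple → Tuple → List (Word N) → Carrier
  headBlockTerm A G Φ []      = 0#
  headBlockTerm A G Φ (q ∷ p) = ∑Fin (λ m → Φ m q * blockTerm (∂ m A) G p)

  blockTerm-∷ : ∀ A G q p → blockTerm A G (q ∷ p) ≈ headBlockTerm A G G (q ∷ p)
  blockTerm-∷ A G q p = begin
    blockTerm A G (q ∷ p)
      ≈⟨ ∑-concatMap (allFin N) (λ j → map (j ∷_) (allWords N (length p))) _ ⟩
    ∑Fin (λ j → ∑ (map (j ∷_) (allWords N (length p))) (λ κ → A κ * Πl (zipWith G κ (q ∷ p))))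
      ≈⟨ ∑-cong (allFin N) (λ j → ∑-map (allWords N (length p)) (j ∷_) _) ⟩
    ∑Fin (λ j → ∑ (allWords N (length p)) (λ κ → A (j ∷ κ) * (G j q * Πl (zipWith G κ p))))
      ≈⟨ ∑-cong (allFin N) (λ j → ∑-cong (allWords N (length p)) (λ κ → x∙yz≈y∙xz (A (j ∷ κ)) (G j q) _)) ⟩
    ∑Fin (λ j → ∑ (allWords N (length p)) (λ κ → G j q * (A (j ∷ κ) * Πl (zipWith G κ p))))
      ≈⟨ ∑-cong (allFin N) (λ j → *-distribˡ-∑ (allWords N (length p)) (G j q) _) ⟩
    headBlockTerm A G G (q ∷ p) ∎

  -- The weight Φ of the first block is generalised so that the induction on w, which peels letters off
  -- the first block, goes through.
  ∑-headBlockTerm : ∀ A G Φ a w →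
    ∑ (splits′ (a ∷ w)) (headBlockTerm A G Φ) ≈ ∑Fin (λ m → (∂ a (Φ m) · ∂ m A ⟦ G ⟧) w)
  ∑-headBlockTerm A G Φ a w = begin
    ∑ (splits′ (a ∷ w)) (headBlockTerm A G Φ)
      ≈⟨ ∑-concatMap (splits′ w) (splitStep a) _ ⟩
    ∑ (splits′ w) (λ p → ∑ (splitStep a p) (headBlockTerm A G Φ))
      ≈⟨ ∑-cong (splits′ w) step ⟩
    ∑ (splits′ w) (λ p → ∑Fin (λ m → Φ m [ a ] * blockTerm (∂ m A) G p) + headBlockTerm A G Φ′ p)
      ≈⟨ ∑-distrib-+ (splits′ w) _ _ ⟩
    ∑ (splits′ w) (λ p → ∑Fin (λ m → Φ m [ a ] * blockTerm (∂ m A) G p)) + ∑ (splits′ w) (headBlockTerm A G Φ′)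
      ≈⟨ +-congʳ (∑-comm (splits′ w) (allFin N) _) ⟩
    ∑Fin (λ m → ∑ (splits′ w) (λ p → Φ m [ a ] * blockTerm (∂ m A) G p)) + ∑ (splits′ w) (headBlockTerm A G Φ′)
      ≈⟨ +-congʳ (∑-cong (allFin N) (λ m → trans (*-distribˡ-∑ (splits′ w) _ _) (*-congˡ (sym (⟦⟧-blocks (∂ m A) G w))))) ⟩
    ∑Fin (λ m → Φ m [ a ] * (∂ m A ⟦ G ⟧) w) + ∑ (splits′ w) (headBlockTerm A G Φ′)
      ≈⟨ rest w ⟩
    ∑Fin (λ m → (∂ a (Φ m) · ∂ m A ⟦ G ⟧) w) ∎
    where
    Φ′ : Tuple
    Φ′ m = ∂ a (Φ m)
    step : ∀ p → ∑ (splitStep a p) (headBlockTerm A G Φ) ≈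
                 ∑Fin (λ m → Φ m [ a ] * blockTerm (∂ m A) G p) + headBlockTerm A G Φ′ p
    step []       = refl
    step (q ∷ ps) = +-congˡ (+-identityʳ _)
    rest : ∀ w → ∑Fin (λ m → Φ m [ a ] * (∂ m A ⟦ G ⟧) w) + ∑ (splits′ w) (headBlockTerm A G Φ′) ≈
                 ∑Fin (λ m → (∂ a (Φ m) · ∂ m A ⟦ G ⟧) w)
    rest []      = trans (+-congˡ (+-identityʳ 0#)) (+-identityʳ _)
    rest (b ∷ w) = trans (+-congˡ (∑-headBlockTerm A G Φ′ b w)) (sym (∑-distrib-+ (allFin N) _ _))

  ⟦⟧-∷ : ∀ A G a w → (A ⟦ G ⟧) (a ∷ w) ≈ ∑Fin (λ m → (∂ a (G m) · ∂ m A ⟦ G ⟧) w)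
  ⟦⟧-∷ A G a w = begin
    (A ⟦ G ⟧) (a ∷ w)                                      ≈⟨ ⟦⟧-blocks A G (a ∷ w) ⟩
    ∑ (splits′ (a ∷ w)) (blockTerm A G)                    ≈⟨ ∑-concatMap (splits′ w) (splitStep a) _ ⟩
    ∑ (splits′ w) (λ p → ∑ (splitStep a p) (blockTerm A G)) ≈⟨ ∑-cong (splits′ w) step ⟩
    ∑ (splits′ w) (λ p → ∑ (splitStep a p) (headBlockTerm A G G)) ≈⟨ ∑-concatMap (splits′ w) (splitStep a) _ ⟨
    ∑ (splits′ (a ∷ w)) (headBlockTerm A G G)              ≈⟨ ∑-headBlockTerm A G G a w ⟩
    ∑Fin (λ m → (∂ a (G m) · ∂ m A ⟦ G ⟧) w)               ∎
    where
    step : ∀ p → ∑ (splitStep a p) (blockTerm A G) ≈ ∑ (splitStep a p) (headBlockTerm A G G)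
    step []       = +-congʳ (blockTerm-∷ A G [ a ] [])
    step (q ∷ ps) = +-cong (blockTerm-∷ A G [ a ] (q ∷ ps)) (+-congʳ (blockTerm-∷ A G (a ∷ q) ps))

  ⟦⟧-congˡ : ∀ {A A'} G → (∀ κ → A κ ≈ A' κ) → ∀ w → (A ⟦ G ⟧) w ≈ (A' ⟦ G ⟧) w
  ⟦⟧-congˡ {A} {A'} G A≈A' w = begin
    (A ⟦ G ⟧) w                      ≈⟨ ⟦⟧-blocks A G w ⟩
    ∑ (splits′ w) (blockTerm A G)    ≈⟨ ∑-cong (splits′ w) (λ p → ∑-cong (allWords N (length p)) (λ κ → *-congʳ (A≈A' κ))) ⟩
    ∑ (splits′ w) (blockTerm A' G)   ≈⟨ ⟦⟧-blocks A' G w ⟨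
    (A' ⟦ G ⟧) w                     ∎

  ⟦⟧-linear : ∀ a X Y G w → ((λ u → a * X u + Y u) ⟦ G ⟧) w ≈ a * (X ⟦ G ⟧) w + (Y ⟦ G ⟧) w
  ⟦⟧-linear a X Y G w = begin
    ((λ u → a * X u + Y u) ⟦ G ⟧) w                  ≈⟨ ⟦⟧-blocks _ G w ⟩
    ∑ (splits′ w) (blockTerm (λ u → a * X u + Y u) G) ≈⟨ ∑-cong (splits′ w) linear ⟩
    ∑ (splits′ w) (λ p → a * blockTerm X G p + blockTerm Y G p) ≈⟨ ∑-distrib-+ (splits′ w) _ _ ⟩
    ∑ (splits′ w) (λ p → a * blockTerm X G p) + ∑ (splits′ w) (blockTerm Y G)
      ≈⟨ +-cong (trans (*-distribˡ-∑ (splits′ w) a _) (*-congˡ (sym (⟦⟧-blocks X G w)))) (sym (⟦⟧-blocks Y G w)) ⟩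
    a * (X ⟦ G ⟧) w + (Y ⟦ G ⟧) w                    ∎
    where
    linear : ∀ p → blockTerm (λ u → a * X u + Y u) G p ≈ a * blockTerm X G p + blockTerm Y G p
    linear p = trans (∑-cong (allWords N (length p)) (λ κ → *-linearʳ a (X κ) (Y κ) _))
                     (trans (∑-distrib-+ (allWords N (length p)) _ _) (+-congʳ (*-distribˡ-∑ (allWords N (length p)) a _)))

  ⟦⟧-zero : ∀ G w → ((λ _ → 0#) ⟦ G ⟧) w ≈ 0#
  ⟦⟧-zero G w = trans (⟦⟧-blocks _ G w)
    (∑-zero (splits′ w) (λ p → ∑-zero (allWords N (length p)) (λ κ → zeroˡ _)))

  ⟦⟧-∑ : {B : Set} (xs : List B) (f : B → PS) → ∀ G w →
         ((λ u → ∑ xs (λ k → f k u)) ⟦ G ⟧) w ≈ ∑ xs (λ k → (f k ⟦ G ⟧) w)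
  ⟦⟧-∑ []       f G w = ⟦⟧-zero G w
  ⟦⟧-∑ (x ∷ xs) f G w = begin
    ((λ u → f x u + ∑ xs (λ k → f k u)) ⟦ G ⟧) w      ≈⟨ ⟦⟧-congˡ G (λ κ → +-congʳ (*-identityˡ _)) w ⟨
    ((λ u → 1# * f x u + ∑ xs (λ k → f k u)) ⟦ G ⟧) w ≈⟨ ⟦⟧-linear 1# (f x) _ G w ⟩
    1# * (f x ⟦ G ⟧) w + ((λ u → ∑ xs (λ k → f k u)) ⟦ G ⟧) w ≈⟨ +-cong (*-identityˡ _) (⟦⟧-∑ xs f G w) ⟩
    (f x ⟦ G ⟧) w + ∑ xs (λ k → (f k ⟦ G ⟧) w)        ∎

  ⟦⟧-congʳ-≤ : ∀ n {G G'} → G ≋[≤ n ] G' → ∀ A → A ⟦ G ⟧ ≈[≤ n ] A ⟦ G' ⟧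
  ⟦⟧-congʳ-≤ n       {G} {G'} G≈G' A []      _ = trans (⟦⟧-[] A G) (sym (⟦⟧-[] A G'))
  ⟦⟧-congʳ-≤ (suc n) {G} {G'} G≈G' A (a ∷ w) (s≤s |w|≤n) = begin
    (A ⟦ G ⟧) (a ∷ w)                          ≈⟨ ⟦⟧-∷ A G a w ⟩
    ∑Fin (λ m → (∂ a (G m) · ∂ m A ⟦ G ⟧) w)
      ≈⟨ ∑-cong (allFin N) (λ m → ·-cong-≤ w (G≈G′ m) (≈[≤]-weaken |w|≤n (⟦⟧-congʳ-≤ n G≈G'′ (∂ m A)))) ⟩
    ∑Fin (λ m → (∂ a (G' m) · ∂ m A ⟦ G' ⟧) w) ≈⟨ ⟦⟧-∷ A G' a w ⟨
    (A ⟦ G' ⟧) (a ∷ w)                         ∎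
    where
    G≈G′ : ∀ m → ∂ a (G m) ≈[≤ length w ] ∂ a (G' m)
    G≈G′ m u |u|≤|w| = G≈G' m (a ∷ u) (s≤s (≤-trans |u|≤|w| |w|≤n))
    G≈G'′ : G ≋[≤ n ] G'
    G≈G'′ m = ≈[≤]-weaken (n≤1+n n) (G≈G' m)

  ⟦⟧-congʳ-≤⁺ : ∀ n {G G'} → G ≋[≤ n ] G' → ∀ A → (∀ m → A [ m ] ≈ 0#) → A ⟦ G ⟧ ≈[≤ suc n ] A ⟦ G' ⟧
  ⟦⟧-congʳ-≤⁺ n {G} {G'} G≈G' A A₁≈0 []      _ = trans (⟦⟧-[] A G) (sym (⟦⟧-[] A G'))
  ⟦⟧-congʳ-≤⁺ n {G} {G'} G≈G' A A₁≈0 (a ∷ w) (s≤s |w|≤n) = begin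
    (A ⟦ G ⟧) (a ∷ w)                          ≈⟨ ⟦⟧-∷ A G a w ⟩
    ∑Fin (λ m → (∂ a (G m) · ∂ m A ⟦ G ⟧) w)   ≈⟨ ∑-cong (allFin N) factor ⟩
    ∑Fin (λ m → (∂ a (G' m) · ∂ m A ⟦ G' ⟧) w) ≈⟨ ⟦⟧-∷ A G' a w ⟨
    (A ⟦ G' ⟧) (a ∷ w)                         ∎
    where
    factor : ∀ m → (∂ a (G m) · ∂ m A ⟦ G ⟧) w ≈ (∂ a (G' m) · ∂ m A ⟦ G' ⟧) w
    factor m = ·-cong-< w (trans (⟦⟧-[] (∂ m A) G) (A₁≈0 m)) (trans (⟦⟧-[] (∂ m A) G') (A₁≈0 m))
                 (λ u |u|<|w| → G≈G' m (a ∷ u) (≤-trans |u|<|w| |w|≤n))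
                 (≈[≤]-weaken |w|≤n (⟦⟧-congʳ-≤ n G≈G' (∂ m A)))

  ⟦⟧-·-≤ : ∀ k F B C → (B · C) ⟦ F ⟧ ≈[≤ k ] (B ⟦ F ⟧) · (C ⟦ F ⟧)
  ⟦⟧-·-≤ k       F B C []      _ = trans (⟦⟧-[] (B · C) F) (sym (*-cong (⟦⟧-[] B F) (⟦⟧-[] C F)))
  ⟦⟧-·-≤ (suc k) F B C (a ∷ w) (s≤s |w|≤k) = begin
    ((B · C) ⟦ F ⟧) (a ∷ w)
      ≈⟨ ⟦⟧-∷ (B · C) F a w ⟩
    ∑Fin (λ m → (∂ a (F m) · ∂ m (B · C) ⟦ F ⟧) w)
      ≈⟨ ∑-cong (allFin N) (λ m → ·-cong-≤ w (λ _ _ → refl) (λ v |v|≤|w| →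
           trans (⟦⟧-linear (B []) (∂ m C) (∂ m B · C) F v) (+-congˡ (⟦⟧-·-≤ k F (∂ m B) C v (≤-trans |v|≤|w| |w|≤k))))) ⟩
    ∑Fin (λ m → (∂ a (F m) · (λ v → B [] * (∂ m C ⟦ F ⟧) v + ((∂ m B ⟦ F ⟧) · (C ⟦ F ⟧)) v)) w)
      ≈⟨ ∑-cong (allFin N) (λ m → ·-linearʳ (B []) _ _ (∂ a (F m)) w) ⟩
    ∑Fin (λ m → B [] * (∂ a (F m) · ∂ m C ⟦ F ⟧) w + (∂ a (F m) · ((∂ m B ⟦ F ⟧) · (C ⟦ F ⟧))) w)
      ≈⟨ ∑-distrib-+ (allFin N) _ _ ⟩
    ∑Fin (λ m → B [] * (∂ a (F m) · ∂ m C ⟦ F ⟧) w) + ∑Fin (λ m → (∂ a (F m) · ((∂ m B ⟦ F ⟧) · (C ⟦ F ⟧))) w)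
      ≈⟨ +-cong (trans (*-distribˡ-∑ (allFin N) (B []) _) (*-cong (sym (⟦⟧-[] B F)) (sym (⟦⟧-∷ C F a w))))
                (∑-cong (allFin N) (λ m → sym (·-assoc _ _ _ w))) ⟩
    (B ⟦ F ⟧) [] * (C ⟦ F ⟧) (a ∷ w) + ∑Fin (λ m → ((∂ a (F m) · ∂ m B ⟦ F ⟧) · (C ⟦ F ⟧)) w)
      ≈⟨ +-congˡ (·-distribʳ-∑ (allFin N) _ (C ⟦ F ⟧) w) ⟨
    (B ⟦ F ⟧) [] * (C ⟦ F ⟧) (a ∷ w) + ((λ u → ∑Fin (λ m → (∂ a (F m) · ∂ m B ⟦ F ⟧) u)) · (C ⟦ F ⟧)) w
      ≈⟨ +-congˡ (·-cong (λ u → sym (⟦⟧-∷ B F a u)) (λ _ → refl) w) ⟩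
    ((B ⟦ F ⟧) · (C ⟦ F ⟧)) (a ∷ w) ∎

  ⟦⟧-· : ∀ F B C w → ((B · C) ⟦ F ⟧) w ≈ ((B ⟦ F ⟧) · (C ⟦ F ⟧)) w
  ⟦⟧-· F B C w = ⟦⟧-·-≤ (length w) F B C w ≤-refl

  ⟦⟧-assoc-≤ : ∀ k G F A → A ⟦ G ⟧ ⟦ F ⟧ ≈[≤ k ] A ⟦ G ∘ₛ F ⟧
  ⟦⟧-assoc-≤ k       G F A []      _ = trans (⟦⟧-[] (A ⟦ G ⟧) F) (trans (⟦⟧-[] A G) (sym (⟦⟧-[] A (G ∘ₛ F))))
  ⟦⟧-assoc-≤ (suc k) G F A (a ∷ w) (s≤s |w|≤k) = begin
    (A ⟦ G ⟧ ⟦ F ⟧) (a ∷ w)                                ≈⟨ ⟦⟧-∷ (A ⟦ G ⟧) F a w ⟩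
    ∑Fin (λ m → (∂ a (F m) · ∂ m (A ⟦ G ⟧) ⟦ F ⟧) w)
      ≈⟨ ∑-cong (allFin N) (λ m → ·-cong-≤ w (λ _ _ → refl) (λ v |v|≤|w| → inner m v (≤-trans |v|≤|w| |w|≤k))) ⟩
    ∑Fin (λ m → (∂ a (F m) · (λ v → ∑Fin (λ j → (P m j · Q j) v))) w)
      ≈⟨ ∑-cong (allFin N) (λ m → ·-distribˡ-∑ (allFin N) _ (∂ a (F m)) w) ⟩
    ∑Fin (λ m → ∑Fin (λ j → (∂ a (F m) · (P m j · Q j)) w))
      ≈⟨ ∑-cong (allFin N) (λ m → ∑-cong (allFin N) (λ j → sym (·-assoc _ _ _ w))) ⟩
    ∑Fin (λ m → ∑Fin (λ j → ((∂ a (F m) · P m j) · Q j) w)) ≈⟨ ∑-comm (allFin N) (allFin N) _ ⟩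
    ∑Fin (λ j → ∑Fin (λ m → ((∂ a (F m) · P m j) · Q j) w))
      ≈⟨ ∑-cong (allFin N) (λ j → sym (·-distribʳ-∑ (allFin N) _ (Q j) w)) ⟩
    ∑Fin (λ j → ((λ u → ∑Fin (λ m → (∂ a (F m) · P m j) u)) · Q j) w)
      ≈⟨ ∑-cong (allFin N) (λ j → ·-cong (λ u → sym (⟦⟧-∷ (G j) F a u)) (λ _ → refl) w) ⟩
    ∑Fin (λ j → (∂ a ((G ∘ₛ F) j) · Q j) w)                ≈⟨ ⟦⟧-∷ A (G ∘ₛ F) a w ⟨
    (A ⟦ G ∘ₛ F ⟧) (a ∷ w)                                 ∎
    where
    P : Fin N → Fin N → PS
    P m j = ∂ m (G j) ⟦ F ⟧
    Q : Fin N → PS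
    Q j = ∂ j A ⟦ G ∘ₛ F ⟧
    inner : ∀ m v → length v ≤ k → (∂ m (A ⟦ G ⟧) ⟦ F ⟧) v ≈ ∑Fin (λ j → (P m j · Q j) v)
    inner m v |v|≤k = begin
      (∂ m (A ⟦ G ⟧) ⟦ F ⟧) v                                       ≈⟨ ⟦⟧-congˡ F (⟦⟧-∷ A G m) v ⟩
      ((λ u → ∑Fin (λ j → (∂ m (G j) · ∂ j A ⟦ G ⟧) u)) ⟦ F ⟧) v   ≈⟨ ⟦⟧-∑ (allFin N) _ F v ⟩
      ∑Fin (λ j → ((∂ m (G j) · ∂ j A ⟦ G ⟧) ⟦ F ⟧) v)              ≈⟨ ∑-cong (allFin N) (λ j → ⟦⟧-· F _ _ v) ⟩
      ∑Fin (λ j → (P m j · ∂ j A ⟦ G ⟧ ⟦ F ⟧) v)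
        ≈⟨ ∑-cong (allFin N) (λ j → ·-cong-≤ v (λ _ _ → refl) (≈[≤]-weaken |v|≤k (⟦⟧-assoc-≤ k G F (∂ j A)))) ⟩
      ∑Fin (λ j → (P m j · Q j) v)                                   ∎

  ⟦⟧-assoc : ∀ G F A w → (A ⟦ G ⟧ ⟦ F ⟧) w ≈ (A ⟦ G ∘ₛ F ⟧) w
  ⟦⟧-assoc G F A w = ⟦⟧-assoc-≤ (length w) G F A w ≤-refl

  Xvar-diag : ∀ a → Xvar a [ a ] ≈ 1#
  Xvar-diag a with a ≟ a
  ... | yes _   = refl
  ... | no a≢a = contradiction ≡.refl a≢a

  Xvar-offdiag : ∀ i m → i ≢ m → Xvar i [ m ] ≈ 0#
  Xvar-offdiag i m i≢m with i ≟ m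
  ... | yes i≡m = contradiction i≡m i≢m
  ... | no _    = refl

  ∂-Xvar : ∀ a m u → ∂ a (Xvar m) u ≈ const (Xvar m [ a ]) u
  ∂-Xvar a m []      = refl
  ∂-Xvar a m (b ∷ u) = refl

  ⟦Xvar⟧ : ∀ A w → (A ⟦ Xvar ⟧) w ≈ A w
  ⟦Xvar⟧ A []      = ⟦⟧-[] A Xvar
  ⟦Xvar⟧ A (a ∷ w) = begin
    (A ⟦ Xvar ⟧) (a ∷ w)                                ≈⟨ ⟦⟧-∷ A Xvar a w ⟩
    ∑Fin (λ m → (∂ a (Xvar m) · ∂ m A ⟦ Xvar ⟧) w)
      ≈⟨ ∑-cong (allFin N) (λ m → trans (·-cong (∂-Xvar a m) (λ _ → refl) w) (·-constˡ _ _ w)) ⟩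
    ∑Fin (λ m → Xvar m [ a ] * (∂ m A ⟦ Xvar ⟧) w)     ≈⟨ ∑-cong (allFin N) (λ m → *-congˡ (⟦Xvar⟧ (∂ m A) w)) ⟩
    ∑Fin (λ m → Xvar m [ a ] * A (m ∷ w))
      ≈⟨ ∑-allFin-δ _ a (λ m m≢a → trans (*-congʳ (Xvar-offdiag m a m≢a)) (zeroˡ _)) ⟩
    Xvar a [ a ] * A (a ∷ w)                            ≈⟨ trans (*-congʳ (Xvar-diag a)) (*-identityˡ _) ⟩
    A (a ∷ w)                                           ∎

  const⟦⟧ : ∀ a G w → (const a ⟦ G ⟧) w ≈ const a w
  const⟦⟧ a G []      = ⟦⟧-[] (const a) G
  const⟦⟧ a G (b ∷ w) = trans (⟦⟧-∷ (const a) G b w)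
    (∑-zero (allFin N) (λ m → trans (·-cong (λ _ → refl) (⟦⟧-zero G) w) (·-zeroʳ _ w)))

  Xvar⟦⟧ : ∀ i G a w → (Xvar i ⟦ G ⟧) (a ∷ w) ≈ G i (a ∷ w)
  Xvar⟦⟧ i G a w = begin
    (Xvar i ⟦ G ⟧) (a ∷ w)                             ≈⟨ ⟦⟧-∷ (Xvar i) G a w ⟩
    ∑Fin (λ m → (∂ a (G m) · ∂ m (Xvar i) ⟦ G ⟧) w)
      ≈⟨ ∑-cong (allFin N) (λ m → trans (·-cong (λ _ → refl)
             (λ v → trans (⟦⟧-congˡ G (∂-Xvar m i) v) (const⟦⟧ _ G v)) w) (·-constʳ _ _ w)) ⟩
    ∑Fin (λ m → G m (a ∷ w) * Xvar i [ m ])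
      ≈⟨ ∑-allFin-δ _ i (λ m m≢i → trans (*-congˡ (Xvar-offdiag i m (m≢i ∘ ≡.sym))) (zeroʳ _)) ⟩
    G i (a ∷ w) * Xvar i [ i ]                         ≈⟨ trans (*-congˡ (Xvar-diag i)) (*-identityʳ _) ⟩
    G i (a ∷ w)                                        ∎

module Inverse {c ℓ} (R : CommutativeRing c ℓ) (N : ℕ) (H : Fin N → Word N → CommutativeRing.Carrier R) where
  open CommutativeRing R hiding (zero)
  open Series R N
  open PowerSeries R N
  open import Relation.Binary.Reasoning.Setoid setoid
  open import Data.Nat.Properties using (≤-refl; ≤-trans)
  open import Algebra.Properties.Ring ring using (-1*x≈-x)
  open import Algebra.Properties.Group +-group using (\\-leftDividesˡ; \\-leftDividesʳ)

  Hₙₗ : Tuple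
  Hₙₗ i []          = 0#
  Hₙₗ i (_ ∷ [])    = 0#
  Hₙₗ i (a ∷ b ∷ w) = H i (a ∷ b ∷ w)

  approx : ℕ → Tuple
  approx zero    i w = Xvar i w
  approx (suc n) i w = Xvar i w + (Hₙₗ i ⟦ approx n ⟧) w

  inverse : Tuple
  inverse i w = approx (length w) i w

  approx-[] : ∀ n i → approx n i [] ≈ 0#
  approx-[] zero    i = refl
  approx-[] (suc n) i = trans (+-congˡ (⟦⟧-[] (Hₙₗ i) (approx n))) (+-identityʳ 0#)

  approx-stable : ∀ n m i u → length u ≤ n → length u ≤ m → approx n i u ≈ approx m i u
  approx-stable n       m       i []      _           _           = trans (approx-[] n i) (sym (approx-[] m i))
  approx-stable (suc n) (suc m) i (a ∷ u) (s≤s |u|≤n) (s≤s |u|≤m) = +-congˡ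
    (⟦⟧-congʳ-≤⁺ (length u) (λ j v |v|≤|u| → approx-stable n m j v (≤-trans |v|≤|u| |u|≤n) (≤-trans |v|≤|u| |u|≤m))
                 (Hₙₗ i) (λ _ → refl) (a ∷ u) ≤-refl)

  inverse-fixpoint : ∀ i w → inverse i w ≈ Xvar i w + (Hₙₗ i ⟦ inverse ⟧) w
  inverse-fixpoint i []      = sym (trans (+-congˡ (⟦⟧-[] (Hₙₗ i) inverse)) (+-identityʳ _))
  inverse-fixpoint i (a ∷ w) = +-congˡ
    (⟦⟧-congʳ-≤⁺ (length w) (λ j v |v|≤|w| → approx-stable (length w) (length v) j v |v|≤|w| ≤-refl)
                 (Hₙₗ i) (λ _ → refl) (a ∷ w) ≤-refl)

  Fof-split : ∀ i u → Fof H i u ≈ (- 1#) * Hₙₗ i u + Xvar i u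
  Fof-split i []          = sym (trans (+-identityʳ _) (zeroʳ _))
  Fof-split i (j ∷ [])    = sym (trans (+-congʳ (zeroʳ _)) (+-identityˡ _))
  Fof-split i (a ∷ b ∷ w) = sym (trans (+-identityʳ _) (-1*x≈-x _))

  F∘inverse : (Fof H ∘ₛ inverse) ≋ I
  F∘inverse i []      = ⟦⟧-[] (Fof H i) inverse
  F∘inverse i (a ∷ w) = begin
    (Fof H i ⟦ inverse ⟧) (a ∷ w)                          ≈⟨ ⟦⟧-congˡ inverse (Fof-split i) (a ∷ w) ⟩
    ((λ u → (- 1#) * Hₙₗ i u + Xvar i u) ⟦ inverse ⟧) (a ∷ w) ≈⟨ ⟦⟧-linear _ (Hₙₗ i) (Xvar i) inverse (a ∷ w) ⟩
    (- 1#) * h + (Xvar i ⟦ inverse ⟧) (a ∷ w)              ≈⟨ +-congˡ (Xvar⟦⟧ i inverse a w) ⟩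
    (- 1#) * h + inverse i (a ∷ w)                         ≈⟨ +-cong (-1*x≈-x h) (inverse-fixpoint i (a ∷ w)) ⟩
    - h + (Xvar i (a ∷ w) + h)                             ≈⟨ +-congˡ (+-comm _ h) ⟩
    - h + (h + Xvar i (a ∷ w))                             ≈⟨ \\-leftDividesʳ h _ ⟩
    Xvar i (a ∷ w)                                         ∎
    where
    h : Carrier
    h = (Hₙₗ i ⟦ inverse ⟧) (a ∷ w)

  inverse∘F-≤ : ∀ k → (inverse ∘ₛ Fof H) ≋[≤ k ] I
  inverse∘F-≤ k       i []      _           = ⟦⟧-[] (inverse i) (Fof H)
  inverse∘F-≤ (suc k) i (a ∷ w) (s≤s |w|≤k) = begin
    (inverse i ⟦ F ⟧) (a ∷ w)
      ≈⟨ ⟦⟧-congˡ F (λ u → trans (inverse-fixpoint i u) (trans (+-comm _ _) (+-congʳ (sym (*-identityˡ _))))) (a ∷ w) ⟩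
    ((λ u → 1# * (Hₙₗ i ⟦ inverse ⟧) u + Xvar i u) ⟦ F ⟧) (a ∷ w) ≈⟨ ⟦⟧-linear 1# _ (Xvar i) F (a ∷ w) ⟩
    1# * (Hₙₗ i ⟦ inverse ⟧ ⟦ F ⟧) (a ∷ w) + (Xvar i ⟦ F ⟧) (a ∷ w)
      ≈⟨ +-cong (trans (*-identityˡ _) (⟦⟧-assoc inverse F (Hₙₗ i) (a ∷ w))) (Xvar⟦⟧ i F a w) ⟩
    (Hₙₗ i ⟦ inverse ∘ₛ F ⟧) (a ∷ w) + F i (a ∷ w)
      ≈⟨ +-cong (⟦⟧-congʳ-≤⁺ k (inverse∘F-≤ k) (Hₙₗ i) (λ _ → refl) (a ∷ w) (s≤s |w|≤k)) (Fof-split i (a ∷ w)) ⟩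
    (Hₙₗ i ⟦ Xvar ⟧) (a ∷ w) + ((- 1#) * Hₙₗ i (a ∷ w) + Xvar i (a ∷ w))
      ≈⟨ +-cong (⟦Xvar⟧ (Hₙₗ i) (a ∷ w)) (+-congʳ (-1*x≈-x _)) ⟩
    Hₙₗ i (a ∷ w) + (- Hₙₗ i (a ∷ w) + Xvar i (a ∷ w))     ≈⟨ \\-leftDividesˡ _ _ ⟩
    Xvar i (a ∷ w)                                         ∎
    where
    F : Tuple
    F = Fof H

  inverse∘F : (inverse ∘ₛ Fof H) ≋ I
  inverse∘F i w = inverse∘F-≤ (length w) i w ≤-refl

  inverse-linear : ∀ i j → inverse i [ j ] ≈ Xvar i [ j ]
  inverse-linear i j = trans (+-congˡ (trans (⟦⟧-∷ (Hₙₗ i) (approx 0) j [])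
    (∑-zero (allFin N) (λ m → trans (*-congˡ (⟦⟧-[] (∂ m (Hₙₗ i)) (approx 0))) (zeroʳ _))))) (+-identityʳ _)

module TreeEnumeration (N : ℕ) where
  open Combinatorics
  open import Data.List.Membership.Propositional.Properties using (∈-++⁺ˡ; ∈-++⁺ʳ; ∈-++⁻; ∈-map⁺; ∈-map⁻)
  open import Data.List.Properties using (length-map; length-++)
  open import Data.List.Relation.Unary.Unique.Propositional.Properties using (++⁺; map⁺)
  open import Data.List.Relation.Unary.AllPairs using ([]; _∷_)
  open import Data.List.Relation.Unary.All as All using (All; []; _∷_)
  open import Data.List.Relation.Binary.Pointwise using (Pointwise; []; _∷_)
  open import Data.Nat.Properties using (suc-injective; ≤-trans; ≤-reflexive; ≤-pred; m≤m+n; m≤n+m; m<m+n; +-mono-≤)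
  open import Data.Sum using (inj₁; inj₂)

  leafTrees : Fin N → Word N → List (Tree N)
  leafTrees i (j ∷ []) with i ≟ j
  ... | yes _ = [ leaf j ]
  ... | no  _ = []
  leafTrees i _ = []

  whenBranching : {X : Set} → Word N → List X → List X
  whenBranching (_ ∷ _ ∷ _) xs = xs
  whenBranching _           _  = []

  mutual
    trees : ℕ → Fin N → Word N → List (Tree N)
    trees zero    i w = leafTrees i w
    trees (suc n) i w = leafTrees i w ++ concatMap (nodeTrees n i) (splits′ w)

    nodeTrees : ℕ → Fin N → List (Word N) → List (Tree N)
    nodeTrees n i p = concatMap (nodeTreesOfType n i p) (allWords N (length p))

    nodeTreesOfType : ℕ → Fin N → List (Word N) → Word N → List (Tree N)
    nodeTreesOfType n i p ρ = map (node i) (whenBranching ρ (choices (zipWith (trees n) ρ p)))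

  leafTrees-sound : ∀ {i w t} → t ∈ leafTrees i w → InS i w t
  leafTrees-sound {i} {j ∷ []} t∈ with i ≟ j
  leafTrees-sound {i} {j ∷ []} (here ≡.refl) | yes i≡j = leafR j , ≡.sym i≡j , ≡.refl

  ∈-whenBranching⁻ : {X : Set} (ρ : Word N) {xs : List X} {x : X} → x ∈ whenBranching ρ xs → 2 ≤ length ρ × x ∈ xs
  ∈-whenBranching⁻ (_ ∷ _ ∷ _) x∈ = s≤s (s≤s z≤n) , x∈

  record NodeTree (n : ℕ) (i : Fin N) (w : Word N) (t : Tree N) : Set where
    field
      blocks    : List (Word N)
      types     : Word N
      children  : List (Tree N)
      blocks∈   : blocks ∈ splits′ w
      types∈    : types ∈ allWords N (length blocks)
      branching : 2 ≤ length types
      children∈ : children ∈ choices (zipWith (trees n) types blocks)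
      t≡node    : t ≡ node i children

  ∈-nodeTrees⁻ : ∀ n {i w t} → t ∈ concatMap (nodeTrees n i) (splits′ w) → NodeTree n i w t
  ∈-nodeTrees⁻ n {i} {w} t∈ with ∈-concatMap⁻′ (nodeTrees n i) (splits′ w) t∈
  ... | p , p∈ , t∈′ with ∈-concatMap⁻′ (nodeTreesOfType n i p) (allWords N (length p)) t∈′
  ... | ρ , ρ∈ , t∈″ with ∈-map⁻ (node i) t∈″
  ... | ts , ts∈ , t≡node with ∈-whenBranching⁻ ρ ts∈
  ... | 2≤|ρ| , ts∈′ = record
    { blocks = p ; types = ρ ; children = ts ; blocks∈ = p∈ ; types∈ = ρ∈
    ; branching = 2≤|ρ| ; children∈ = ts∈′ ; t≡node = t≡node }

  leavesF≡concat : (ts : List (Tree N)) → leavesF ts ≡ concat (map leaves ts)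
  leavesF≡concat []       = ≡.refl
  leavesF≡concat (t ∷ ts) = ≡.cong (leaves t ++_) (leavesF≡concat ts)

  mutual
    trees-sound : ∀ n {i w t} → t ∈ trees n i w → InS i w t
    trees-sound zero    t∈ = leafTrees-sound t∈
    trees-sound (suc n) {i} {w} t∈ with ∈-++⁻ (leafTrees i w) t∈
    ... | inj₁ t∈leafs = leafTrees-sound t∈leafs
    ... | inj₂ t∈nodes = nodeTree-sound n (∈-nodeTrees⁻ n t∈nodes)

    nodeTree-sound : ∀ n {i w t} → NodeTree n i w t → InS i w t
    nodeTree-sound n {i} {w} record { blocks = p ; types = ρ ; children = ts ; blocks∈ = p∈ ; types∈ = ρ∈
                                    ; branching = 2≤|ρ| ; children∈ = ts∈ ; t≡node = ≡.refl }
      with forest-sound n {ρ} {p} (allWords-length N (length p) ρ∈) (∈-choices⁻ _ ts∈)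
    ... | ts-Reduced , ≡.refl , ≡.refl =
      nodeR i ts (≡.subst (2 ≤_) (length-map τ ts) 2≤|ρ|) ts-Reduced , ≡.refl ,
      ≡.trans (leavesF≡concat ts) (concat-splits w p∈)

    forest-sound : ∀ n {ρ p ts} → length ρ ≡ length p → Pointwise _∈_ ts (zipWith (trees n) ρ p) →
                   All Reduced ts × map τ ts ≡ ρ × map leaves ts ≡ p
    forest-sound n {[]}    {[]}    _       []         = [] , ≡.refl , ≡.refl
    forest-sound n {i ∷ ρ} {w ∷ p} |ρ|≡|p| (t∈ ∷ ts∈) with trees-sound n t∈ | forest-sound n (suc-injective |ρ|≡|p|) ts∈
    ... | t-Reduced , ≡.refl , ≡.refl | ts-Reduced , ≡.refl , ≡.refl = t-Reduced ∷ ts-Reduced , ≡.refl , ≡.refl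

  ∈-nodeTreesOfType⁻ : ∀ n {i p ρ z} → length ρ ≡ length p → z ∈ nodeTreesOfType n i p ρ →
                       ∃ λ ts → z ≡ node i ts × map τ ts ≡ ρ × map leaves ts ≡ p
  ∈-nodeTreesOfType⁻ n {i} {p} {ρ} |ρ|≡|p| z∈ with ∈-map⁻ (node i) z∈
  ... | ts , ts∈ , z≡node with forest-sound n |ρ|≡|p| (∈-choices⁻ _ (proj₂ (∈-whenBranching⁻ ρ ts∈)))
  ... | _ , τs≡ρ , leaves≡p = ts , z≡node , τs≡ρ , leaves≡p

  leafTrees-Unique : ∀ i w → Unique (leafTrees i w)
  leafTrees-Unique i []          = []
  leafTrees-Unique i (j ∷ []) with i ≟ j
  ... | yes _ = [] ∷ []
  ... | no  _ = []
  leafTrees-Unique i (_ ∷ _ ∷ _) = []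

  leafTrees-leaf : ∀ {i w t} → t ∈ leafTrees i w → ∃ λ j → t ≡ leaf j
  leafTrees-leaf {i} {j ∷ []} t∈ with i ≟ j
  leafTrees-leaf {i} {j ∷ []} (here ≡.refl) | yes _ = j , ≡.refl

  whenBranching-Unique : {X : Set} (ρ : Word N) {xs : List X} → Unique xs → Unique (whenBranching ρ xs)
  whenBranching-Unique []          _   = []
  whenBranching-Unique (_ ∷ [])    _   = []
  whenBranching-Unique (_ ∷ _ ∷ _) !xs = !xs

  node-injective : ∀ {i} {ts ts′ : List (Tree N)} → node i ts ≡ node i ts′ → ts ≡ ts′
  node-injective ≡.refl = ≡.refl

  trees-Unique : ∀ n i w → Unique (trees n i w)
  trees-Unique zero    i w = leafTrees-Unique i w
  trees-Unique (suc n) i w =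
    ++⁺ (leafTrees-Unique i w)
        (concatMap-Unique (nodeTrees n i) (splits-Unique w) (λ {p} _ → nodeTrees-Unique p) same-blocks)
        leaf∉nodes
    where
    shape : ∀ {p ρ z} → ρ ∈ allWords N (length p) → z ∈ nodeTreesOfType n i p ρ →
            ∃ λ ts → z ≡ node i ts × map τ ts ≡ ρ × map leaves ts ≡ p
    shape {p} ρ∈ = ∈-nodeTreesOfType⁻ n (allWords-length N (length p) ρ∈)
    same-types : ∀ {p ρ ρ′ z} → ρ ∈ allWords N (length p) → ρ′ ∈ allWords N (length p) →
                 z ∈ nodeTreesOfType n i p ρ → z ∈ nodeTreesOfType n i p ρ′ → ρ ≡ ρ′
    same-types ρ∈ ρ′∈ z∈ z∈′ =
      let _ , z≡ , τs≡ρ , _ = shape ρ∈ z∈ ; _ , z≡′ , τs≡ρ′ , _ = shape ρ′∈ z∈′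
      in ≡.trans (≡.sym τs≡ρ) (≡.trans (≡.cong (map τ) (node-injective (≡.trans (≡.sym z≡) z≡′))) τs≡ρ′)
    nodeTrees-Unique : ∀ p → Unique (nodeTrees n i p)
    nodeTrees-Unique p = concatMap-Unique (nodeTreesOfType n i p) (allWords-Unique N (length p))
      (λ {ρ} _ → map⁺ node-injective (whenBranching-Unique ρ (choices-Unique _ (All-zipWith (trees n) (trees-Unique n) ρ p))))
      same-types
    same-blocks : ∀ {p p′ z} → p ∈ splits′ w → p′ ∈ splits′ w → z ∈ nodeTrees n i p → z ∈ nodeTrees n i p′ → p ≡ p′
    same-blocks {p} {p′} _ _ z∈ z∈′
      with ∈-concatMap⁻′ (nodeTreesOfType n i p) (allWords N (length p)) z∈
         | ∈-concatMap⁻′ (nodeTreesOfType n i p′) (allWords N (length p′)) z∈′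
    ... | _ , ρ∈ , z∈ρ | _ , ρ′∈ , z∈ρ′ =
      let _ , z≡ , _ , leaves≡p = shape ρ∈ z∈ρ ; _ , z≡′ , _ , leaves≡p′ = shape ρ′∈ z∈ρ′
      in ≡.trans (≡.sym leaves≡p) (≡.trans (≡.cong (map leaves) (node-injective (≡.trans (≡.sym z≡) z≡′))) leaves≡p′)
    leaf∉nodes : ∀ {z} → z ∈ leafTrees i w × z ∈ concatMap (nodeTrees n i) (splits′ w) → ⊥
    leaf∉nodes (z∈leafs , z∈nodes) with leafTrees-leaf {i} {w} z∈leafs | NodeTree.t≡node (∈-nodeTrees⁻ n {i} {w} z∈nodes)
    ... | _ , ≡.refl | ()

  leaves-NonEmpty : ∀ {t} → Reduced t → NonEmpty (leaves t)
  leaves-NonEmpty (leafR j)                          = nonEmpty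
  leaves-NonEmpty (nodeR i (t ∷ ts) _ (t-Reduced ∷ _)) = NonEmpty-++ (leaves-NonEmpty t-Reduced)
    where
    NonEmpty-++ : {xs ys : Word N} → NonEmpty xs → NonEmpty (xs ++ ys)
    NonEmpty-++ nonEmpty = nonEmpty

  1≤length-leaves : ∀ {t} → Reduced t → 1 ≤ length (leaves t)
  1≤length-leaves t-Reduced = NonEmpty⇒1≤length (leaves-NonEmpty t-Reduced)
    where
    NonEmpty⇒1≤length : {xs : Word N} → NonEmpty xs → 1 ≤ length xs
    NonEmpty⇒1≤length nonEmpty = s≤s z≤n

  ∈⇒length-leaves-≤ : ∀ {t} {ts : List (Tree N)} → t ∈ ts → length (leaves t) ≤ length (leavesF ts)
  ∈⇒length-leaves-≤ {ts = t ∷ ts} (here ≡.refl) =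
    ≤-trans (m≤m+n _ _) (≤-reflexive (≡.sym (length-++ (leaves t))))
  ∈⇒length-leaves-≤ {ts = t′ ∷ ts} (there t∈) =
    ≤-trans (∈⇒length-leaves-≤ t∈) (≤-trans (m≤n+m _ _) (≤-reflexive (≡.sym (length-++ (leaves t′)))))

  -- A child has fewer leaves than its parent, because the parent has a second, nonempty child.
  length-leaves-child-< : ∀ {i ts t} → Reduced (node i ts) → t ∈ ts → length (leaves t) < length (leavesF ts)
  length-leaves-child-< (nodeR _ (t₁ ∷ t₂ ∷ ts) _ (_ ∷ t₂-Reduced ∷ _)) (here ≡.refl) =
    ≤-trans (m<m+n _ (≤-trans (1≤length-leaves t₂-Reduced) (∈⇒length-leaves-≤ {ts = t₂ ∷ ts} (here ≡.refl))))
            (≤-reflexive (≡.sym (length-++ (leaves t₁))))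
  length-leaves-child-< (nodeR _ (_ ∷ [])        (s≤s ()) _) _
  length-leaves-child-< (nodeR _ (t₁ ∷ t₂ ∷ ts) _ (t₁-Reduced ∷ _)) (there t∈) =
    ≤-trans (+-mono-≤ (1≤length-leaves t₁-Reduced) (∈⇒length-leaves-≤ t∈))
            (≤-reflexive (≡.sym (length-++ (leaves t₁))))

  ∈-whenBranching⁺ : {X : Set} (ρ : Word N) {xs : List X} {x : X} → 2 ≤ length ρ → x ∈ xs → x ∈ whenBranching ρ xs
  ∈-whenBranching⁺ (_ ∷ [])    (s≤s ()) _
  ∈-whenBranching⁺ (_ ∷ _ ∷ _) _        x∈ = x∈

  leafTrees⊆trees : ∀ n {i w t} → t ∈ leafTrees i w → t ∈ trees n i w
  leafTrees⊆trees zero    t∈ = t∈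
  leafTrees⊆trees (suc n) t∈ = ∈-++⁺ˡ t∈

  ∈-leafTrees : ∀ {i} j → i ≡ j → leaf j ∈ leafTrees i [ j ]
  ∈-leafTrees {i} j i≡j with i ≟ j
  ... | yes _   = here ≡.refl
  ... | no i≢j = contradiction i≡j i≢j

  trees-complete : ∀ n {i w t} → InS i w t → length w ≤ n → t ∈ trees n i w
  trees-complete n       {t = leaf j}    (_ , ≡.refl , ≡.refl) _ = leafTrees⊆trees n (∈-leafTrees j ≡.refl)
  trees-complete zero    {t = node _ _} (t-Reduced , _ , ≡.refl) |w|≤0
    with ≤-trans (1≤length-leaves t-Reduced) |w|≤0
  ... | ()
  trees-complete (suc n) {i} {t = node _ ts} (t-Reduced@(nodeR _ _ 2≤|ts| ts-Reduced) , ≡.refl , ≡.refl) |w|≤1+n =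
    ∈-++⁺ʳ (leafTrees i (leavesF ts))
      (∈-concatMap⁺′ (nodeTrees n i) p∈
        (∈-concatMap⁺′ (nodeTreesOfType n i p) ρ∈
          (∈-map⁺ (node i) (∈-whenBranching⁺ ρ 2≤|ρ| (∈-choices⁺ (children∈ ts (All.tabulate child∈)))))))
    where
    p : List (Word N)
    p = map leaves ts
    ρ : Word N
    ρ = map τ ts
    p∈ : p ∈ splits′ (leavesF ts)
    p∈ = ∈-splits _ p (All-NonEmpty ts ts-Reduced) (≡.sym (leavesF≡concat ts))
      where
      All-NonEmpty : ∀ us → All Reduced us → All NonEmpty (map leaves us)
      All-NonEmpty []       []         = []
      All-NonEmpty (u ∷ us) (r ∷ rs)   = leaves-NonEmpty r ∷ All-NonEmpty us rs
    2≤|ρ| : 2 ≤ length ρ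
    2≤|ρ| = ≡.subst (2 ≤_) (≡.sym (length-map τ ts)) 2≤|ts|
    ρ∈ : ρ ∈ allWords N (length p)
    ρ∈ = ∈-allWords N (length p) ρ (≡.trans (length-map τ ts) (≡.sym (length-map leaves ts)))
    child∈ : ∀ {u} → u ∈ ts → u ∈ trees n (τ u) (leaves u)
    child∈ u∈ = trees-complete n (All.lookup ts-Reduced u∈ , ≡.refl , ≡.refl)
                  (≤-pred (≤-trans (length-leaves-child-< t-Reduced u∈) |w|≤1+n))
    children∈ : ∀ us → All (λ u → u ∈ trees n (τ u) (leaves u)) us →
                Pointwise _∈_ us (zipWith (trees n) (map τ us) (map leaves us))
    children∈ []       []           = []
    children∈ (u ∷ us) (u∈ ∷ us∈) = u∈ ∷ children∈ us us∈

module TreeFormula {c ℓ} (R : CommutativeRing c ℓ) (N : ℕ) (H : Fin N → Word N → CommutativeRing.Carrier R) where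
  open CommutativeRing R hiding (zero)
  open Series R N
  open PowerSeries R N
  open Inverse R N H
  open TreeEnumeration N
  open Combinatorics
  open import Relation.Binary.Reasoning.Setoid setoid
  open import Data.List.Relation.Binary.BagAndSetEquality using (∼bag⇒↭)
  open import Data.List.Membership.Propositional.Properties.WithK using (unique∧set⇒bag)
  open import Data.Nat.Properties using (≤-refl)
  open import Function.Bundles using (mk⇔; Equivalence)

  leafTrees-weight : ∀ i w → ∑ (leafTrees i w) (weight H) ≈ Xvar i w
  leafTrees-weight i []          = refl
  leafTrees-weight i (j ∷ []) with i ≟ j
  ... | yes _ = +-identityʳ _
  ... | no  _ = refl
  leafTrees-weight i (_ ∷ _ ∷ _) = refl

  ∑-weightF-choices : ∀ xss → ∑ (choices xss) (weightF H) ≈ Πl (map (λ xs → ∑ xs (weight H)) xss)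
  ∑-weightF-choices []         = +-identityʳ _
  ∑-weightF-choices (xs ∷ xss) = begin
    ∑ (concatMap (λ x → map (x ∷_) (choices xss)) xs) (weightF H)      ≈⟨ ∑-concatMap xs _ _ ⟩
    ∑ xs (λ x → ∑ (map (x ∷_) (choices xss)) (weightF H))
      ≈⟨ ∑-cong xs (λ x → trans (∑-map (choices xss) (x ∷_) (weightF H)) (*-distribˡ-∑ (choices xss) (weight H x) _)) ⟩
    ∑ xs (λ x → weight H x * ∑ (choices xss) (weightF H))              ≈⟨ *-distribʳ-∑ xs _ (weight H) ⟩
    ∑ xs (weight H) * ∑ (choices xss) (weightF H)                      ≈⟨ *-congˡ (∑-weightF-choices xss) ⟩
    ∑ xs (weight H) * Πl (map (λ xs → ∑ xs (weight H)) xss)            ∎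

  ∑-weight-trees : ∀ n i w → ∑ (trees n i w) (weight H) ≈ approx n i w
  ∑-weight-trees zero    i w = leafTrees-weight i w
  ∑-weight-trees (suc n) i w = begin
    ∑ (leafTrees i w ++ concatMap (nodeTrees n i) (splits′ w)) (weight H)
      ≈⟨ ∑-++ (leafTrees i w) _ (weight H) ⟩
    ∑ (leafTrees i w) (weight H) + ∑ (concatMap (nodeTrees n i) (splits′ w)) (weight H)
      ≈⟨ +-cong (leafTrees-weight i w) (∑-concatMap (splits′ w) (nodeTrees n i) (weight H)) ⟩
    Xvar i w + ∑ (splits′ w) (λ p → ∑ (nodeTrees n i p) (weight H))
      ≈⟨ +-congˡ (∑-cong (splits′ w) nodeTrees-weight) ⟩
    Xvar i w + ∑ (splits′ w) (blockTerm (Hₙₗ i) (approx n))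
      ≈⟨ +-congˡ (⟦⟧-blocks (Hₙₗ i) (approx n) w) ⟨
    approx (suc n) i w ∎
    where
    ∏-trees : ∀ (ρ : Word N) p → Πl (map (λ xs → ∑ xs (weight H)) (zipWith (trees n) ρ p)) ≈ Πl (zipWith (approx n) ρ p)
    ∏-trees []      _       = refl
    ∏-trees (_ ∷ _) []      = refl
    ∏-trees (j ∷ ρ) (u ∷ p) = *-cong (∑-weight-trees n j u) (∏-trees ρ p)
    nodeTreesOfType-weight : ∀ p ρ → length ρ ≡ length p →
      ∑ (nodeTreesOfType n i p ρ) (weight H) ≈ Hₙₗ i ρ * Πl (zipWith (approx n) ρ p)
    nodeTreesOfType-weight p []          _ = sym (zeroˡ _)
    nodeTreesOfType-weight p (_ ∷ [])    _ = sym (zeroˡ _)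
    nodeTreesOfType-weight p ρ@(_ ∷ _ ∷ _) |ρ|≡|p| = begin
      ∑ (map (node i) tss) (weight H)                 ≈⟨ ∑-map tss (node i) (weight H) ⟩
      ∑ tss (λ ts → H i (map τ ts) * weightF H ts)
        ≈⟨ ∑-cong-∈ tss (λ ts ts∈ → *-congʳ (reflexive (≡.cong (H i) (τs≡ρ ts∈)))) ⟩
      ∑ tss (λ ts → H i ρ * weightF H ts)             ≈⟨ *-distribˡ-∑ tss _ _ ⟩
      H i ρ * ∑ tss (weightF H)
        ≈⟨ *-congˡ (trans (∑-weightF-choices (zipWith (trees n) ρ p)) (∏-trees ρ p)) ⟩
      H i ρ * Πl (zipWith (approx n) ρ p)             ∎
      where
      tss : List (List (Tree N))
      tss = choices (zipWith (trees n) ρ p)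
      τs≡ρ : ∀ {ts} → ts ∈ tss → map τ ts ≡ ρ
      τs≡ρ ts∈ = proj₁ (proj₂ (forest-sound n {ρ} {p} |ρ|≡|p| (∈-choices⁻ _ ts∈)))
    nodeTrees-weight : ∀ p → ∑ (nodeTrees n i p) (weight H) ≈ blockTerm (Hₙₗ i) (approx n) p
    nodeTrees-weight p = trans (∑-concatMap (allWords N (length p)) (nodeTreesOfType n i p) (weight H))
      (∑-cong-∈ (allWords N (length p)) (λ ρ ρ∈ → nodeTreesOfType-weight p ρ (allWords-length N (length p) ρ∈)))

  inverse-treeFormula : ∀ i κ (L : List (Tree N)) → Unique L → (∀ t → (t ∈ L) ⇔ InS i κ t) →
                        inverse i κ ≈ Σl (map (weight H) L)
  inverse-treeFormula i κ L L-Unique L⇔InS = sym (trans (∑-↭ (weight H) L↭trees) (∑-weight-trees (length κ) i κ))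
    where
    L↭trees : L ↭ trees (length κ) i κ
    L↭trees = ∼bag⇒↭ (unique∧set⇒bag L-Unique (trees-Unique (length κ) i κ) (mk⇔
      (λ t∈L → trees-complete (length κ) (Equivalence.to (L⇔InS _) t∈L) ≤-refl)
      (λ t∈trees → Equivalence.from (L⇔InS _) (trees-sound (length κ) t∈trees))))

theorem3p3 : ∀ {c ℓ} (R : CommutativeRing c ℓ) (N : ℕ) → 1 ≤ N →
    (H : Fin N → Word N → CommutativeRing.Carrier R) →
    let open CommutativeRing R
        open Series R N
        F = Fof H
    in Σ Tuple λ G →
         ((F ∘ₛ G) ≋ I) × ((G ∘ₛ F) ≋ I)
         × (∀ i → G i [] ≈ 0#)
         × (∀ i j → G i (j ∷ []) ≈ Xvar i (j ∷ []))
         × (∀ i (κ : Word N) → 2 ≤ length κ →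
              (L : List (Tree N)) → Unique L → (∀ t → (t ∈ L) ⇔ InS i κ t) →
              G i κ ≈ Σl (map (weight H) L))
theorem3p3 R N _ H =
  inverse , F∘inverse , inverse∘F , (λ _ → CommutativeRing.refl R) , inverse-linear , (λ i κ _ → inverse-treeFormula i κ)
  where
  open Inverse R N H
  open TreeFormula R N H
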